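{- Let $E=(e_X,e_Y,R)$ be a 0-coherent extension polarity extending the poset $P$, with $e_X:P\to X$ a meet-extension and $e_Y:P\to Y$ a join-extension. Then $E$ is a Galois polarity if and only if both of the following hold: (S1) for all $p\in P$ and $x\in X$: $x\le_X e_X(p)\iff x\mathrel{R}e_Y(p)$; (S2) for all $p\in P$ and $y\in Y$: $e_Y(p)\le_Y y\iff e_X(p)\mathrel{R}y$.
   Context: For a poset $Q$, $q^\uparrow=\{r:r\ge q\}$, $q^\downarrow=\{r:r\le q\}$. An order embedding $e:P\to Q$ is a meet-extension if $q=\bigwedge e[e^{ -1}(q^\uparrow)]$ for all $q\in Q$, and a join-extension if $q=\bigvee e[e^{ -1}(q^\downarrow)]$ for all $q\in Q$. An extension polarity is a triple $(e_X,e_Y,R)$ where $P$ is a poset, $X,Y$ disjoint posets, $e_X:P\to X$, $e_Y:P\to Y$ order embeddings, $R\subseteq X\times Y$. Conditions: (C1) $x_1\le_X x_2$ and $x_2\mathrel{R}y$ imply $x_1\mathrel{R}y$; (C2) $y_1\le_Y y_2$ and $x\mathrel{R}y_1$ imply $x\mathrel{R}y_2$; (C3) $e_X(p)\mathrel{R}e_Y(p)$ for all $p\in P$; (C4) $x\mathrel{R}e_Y(p)$ and $e_X(p)\mathrel{R}y$ imply $x\mathrel{R}y$; (C5) $x_1\mathrel{R}e_Y(p)$ and $e_X(p)\le_X x_2$ imply $x_1\le_X x_2$; (C6) $y_1\le_Y e_Y(p)$ and $e_X(p)\mathrel{R}y_2$ imply $y_1\le_Y y_2$; (C7) if $S\subseteq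 P$, $\bigwedge e_X[S]=x$ in $X$, $x\mathrel{R}y_2$ and $y_1\le_Y e_Y(p)$ for all $p\in S$, then $y_1\le_Y y_2$; (C8) if $T\subseteq P$, $\bigvee e_Y[T]=y$ in $Y$, $x_1\mathrel{R}y$ and $e_X(q)\le_X x_2$ for all $q\in T$, then $x_1\le_X x_2$. The polarity is 0-coherent if (C1),(C2) hold, and 3-coherent if (C1)–(C8) hold. A Galois polarity is a 3-coherent extension polarity with $e_X$ a meet-extension and $e_Y$ a join-extension. -}

module Defs where

open import Level using (Level; _⊔_; suc)
open import Data.Product using (_×_; Σ; ∃; ∃-syntax; _,_)
open import Relation.Binary.Bundles using (Poset)
open import Relation.Unary using (Pred; _∈_)

module _ {c ℓ₁ ℓ₂ : Level} (Q : Poset c ℓ₁ ℓ₂) where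
  open Poset Q

  IsMeet : {ℓ : Level} → Pred Carrier ℓ → Carrier → Set (c ⊔ ℓ₂ ⊔ ℓ)
  IsMeet S x = (∀ s → s ∈ S → x ≤ s) × (∀ z → (∀ s → s ∈ S → z ≤ s) → z ≤ x)

  IsJoin : {ℓ : Level} → Pred Carrier ℓ → Carrier → Set (c ⊔ ℓ₂ ⊔ ℓ)
  IsJoin S x = (∀ s → s ∈ S → s ≤ x) × (∀ z → (∀ s → s ∈ S → s ≤ z) → x ≤ z)

  up : Carrier → Pred Carrier ℓ₂
  up q r = q ≤ r

  down : Carrier → Pred Carrier ℓ₂
  down q r = r ≤ q

module _ {c₁ ℓ₁ ℓ₂ c₂ ℓ₃ ℓ₄ : Level} (P : Poset c₁ ℓ₁ ℓ₂) (Q : Poset c₂ ℓ₃ ℓ₄) where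
  private
    module P = Poset P
    module Q = Poset Q

  IsOrderEmbedding : (P.Carrier → Q.Carrier) → Set (c₁ ⊔ ℓ₂ ⊔ ℓ₄)
  IsOrderEmbedding e = ∀ p p' → (p P.≤ p' → e p Q.≤ e p') × (e p Q.≤ e p' → p P.≤ p')

  image : {ℓ : Level} → (P.Carrier → Q.Carrier) → Pred P.Carrier ℓ → Pred Q.Carrier (c₁ ⊔ ℓ₃ ⊔ ℓ)
  image e S q = ∃[ p ] (p ∈ S × q Q.≈ e p)

  preimage : {ℓ : Level} → (P.Carrier → Q.Carrier) → Pred Q.Carrier ℓ → Pred P.Carrier ℓ
  preimage e T p = e p ∈ T

  IsMeetExtension : (P.Carrier → Q.Carrier) → Set (c₁ ⊔ ℓ₂ ⊔ c₂ ⊔ ℓ₃ ⊔ ℓ₄)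
  IsMeetExtension e = IsOrderEmbedding e × (∀ q → IsMeet Q (image e (preimage e (up Q q))) q)

  IsJoinExtension : (P.Carrier → Q.Carrier) → Set (c₁ ⊔ ℓ₂ ⊔ c₂ ⊔ ℓ₃ ⊔ ℓ₄)
  IsJoinExtension e = IsOrderEmbedding e × (∀ q → IsJoin Q (image e (preimage e (down Q q))) q)

-- Extension polarity data: P, X, Y posets, e_X, e_Y order embeddings, R ⊆ X × Y.
-- (Disjointness of X and Y is automatic: they are distinct types.)
-- Subsets S, T ⊆ P in (C7), (C8) range over predicates on P of level c (the carrier level).
module Polarity {c ℓ₁ ℓ₂ : Level}
  (P X Y : Poset c ℓ₁ ℓ₂)
  (eX : Poset.Carrier P → Poset.Carrier X)
  (eY : Poset.Carrier P → Poset.Carrier Y)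
  (R : Poset.Carrier X → Poset.Carrier Y → Set ℓ₂) where
  private
    module P = Poset P
    module X = Poset X
    module Y = Poset Y

  C1 C2 C3 C4 C5 C6 : Set (c ⊔ ℓ₂)
  C7 C8 : Set (suc c ⊔ ℓ₁ ⊔ ℓ₂)
  C1 = ∀ x₁ x₂ y → x₁ X.≤ x₂ → R x₂ y → R x₁ y
  C2 = ∀ y₁ y₂ x → y₁ Y.≤ y₂ → R x y₁ → R x y₂
  C3 = ∀ p → R (eX p) (eY p)
  C4 = ∀ x y p → R x (eY p) → R (eX p) y → R x y
  C5 = ∀ x₁ x₂ p → R x₁ (eY p) → eX p X.≤ x₂ → x₁ X.≤ x₂
  C6 = ∀ y₁ y₂ p → y₁ Y.≤ eY p → R (eX p) y₂ → y₁ Y.≤ y₂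
  C7 = ∀ (S : Pred P.Carrier c) x y₁ y₂ →
         IsMeet X (image P X eX S) x → R x y₂ →
         (∀ p → p ∈ S → y₁ Y.≤ eY p) → y₁ Y.≤ y₂
  C8 = ∀ (T : Pred P.Carrier c) y x₁ x₂ →
         IsJoin Y (image P Y eY T) y → R x₁ y →
         (∀ q → q ∈ T → eX q X.≤ x₂) → x₁ X.≤ x₂

  IsExtensionPolarity : Set (c ⊔ ℓ₂)
  IsExtensionPolarity = IsOrderEmbedding P X eX × IsOrderEmbedding P Y eY

  Is0Coherent : Set (c ⊔ ℓ₂)
  Is0Coherent = IsExtensionPolarity × C1 × C2

  Is3Coherent : Set (suc c ⊔ ℓ₁ ⊔ ℓ₂)
  Is3Coherent = IsExtensionPolarity × C1 × C2 × C3 × C4 × C5 × C6 × C7 × C8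

  IsGaloisPolarity : Set (suc c ⊔ ℓ₁ ⊔ ℓ₂)
  IsGaloisPolarity = Is3Coherent × IsMeetExtension P X eX × IsJoinExtension P Y eY

  S1 S2 : Set (c ⊔ ℓ₂)
  S1 = ∀ p x → (x X.≤ eX p → R x (eY p)) × (R x (eY p) → x X.≤ eX p)
  S2 = ∀ p y → (eY p Y.≤ y → R (eX p) y) × (R (eX p) y → eY p Y.≤ y)

-- (S1) and (S2) say that R, restricted to X × eY[P] and eX[P] × Y, is the order of X and of Y.
-- This gives (C3)–(C6) at once; conversely (C3), (C5), (C6) with (C1), (C2) give back (S1), (S2).
-- The density conditions (C7), (C8) use that eY is join-dense and eX meet-dense.

module Submission where

open import Defs
open import Level using (Level)
open import Data.Product using (_×_; _,_; proj₁; proj₂)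
open import Function using (flip)
open import Relation.Binary.Bundles using (Poset)
open import Relation.Binary.Construct.Flip.EqAndOrd using () renaming (poset to _ᵒᵖ)
open import Relation.Unary using (Pred; _∈_)

module _ {c₁ ℓ₁ ℓ₂ c₂ ℓ₃ ℓ₄ : Level} {P : Poset c₁ ℓ₁ ℓ₂} {Q : Poset c₂ ℓ₃ ℓ₄}
         {e : Poset.Carrier P → Poset.Carrier Q} where
  private
    module Q = Poset Q

  lowerBound⇒≤meet-image : ∀ {ℓ} {S : Pred (Poset.Carrier P) ℓ} {q z} →
    IsMeet Q (image P Q e S) q → (∀ p → p ∈ S → z Q.≤ e p) → z Q.≤ q
  lowerBound⇒≤meet-image (_ , greatest) z≤eS = greatest _ λ where
    t (p , p∈S , t≈ep) → Q.trans (z≤eS p p∈S) (Q.reflexive (Q.Eq.sym t≈ep))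

  joinExtension-≤ : IsJoinExtension P Q e → ∀ {q₁ q₂} →
    (∀ p → e p Q.≤ q₁ → e p Q.≤ q₂) → q₁ Q.≤ q₂
  joinExtension-≤ (_ , join) {q₁} {q₂} below = proj₂ (join q₁) q₂ λ where
    t (p , ep≤q₁ , t≈ep) → Q.trans (Q.reflexive t≈ep) (below p ep≤q₁)

  orderEmbedding-ᵒᵖ : IsOrderEmbedding P Q e → IsOrderEmbedding (P ᵒᵖ) (Q ᵒᵖ) e
  orderEmbedding-ᵒᵖ emb p p′ = emb p′ p

  meetExtension⇒joinExtension-ᵒᵖ : IsMeetExtension P Q e → IsJoinExtension (P ᵒᵖ) (Q ᵒᵖ) e
  meetExtension⇒joinExtension-ᵒᵖ (emb , meet) = orderEmbedding-ᵒᵖ emb , meet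

module _ {c₁ ℓ₁ ℓ₂ c₂ ℓ₃ ℓ₄ c₃ ℓ₅ ℓ₆ : Level}
         {P : Poset c₁ ℓ₁ ℓ₂} {X : Poset c₂ ℓ₃ ℓ₄} {Y : Poset c₃ ℓ₅ ℓ₆}
         {f : Poset.Carrier P → Poset.Carrier X} {g : Poset.Carrier P → Poset.Carrier Y} where

  ≤-transport : IsOrderEmbedding P X f → IsOrderEmbedding P Y g →
    ∀ {p p′} → Poset._≤_ Y (g p) (g p′) → Poset._≤_ X (f p) (f p′)
  ≤-transport embF embG {p} {p′} gp≤gp′ = proj₁ (embF p p′) (proj₂ (embG p p′) gp≤gp′)

module PolarityProperties {c ℓ₁ ℓ₂ : Level} (P X Y : Poset c ℓ₁ ℓ₂)
         (eX : Poset.Carrier P → Poset.Carrier X) (eY : Poset.Carrier P → Poset.Carrier Y)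
         (R : Poset.Carrier X → Poset.Carrier Y → Set ℓ₂) where
  open Polarity P X Y eX eY R
  private
    module X = Poset X
    module Y = Poset Y

  C1∧C3∧C5⇒S1 : C1 → C3 → C5 → S1
  C1∧C3∧C5⇒S1 c1 c3 c5 p x =
    (λ x≤eXp → c1 x (eX p) (eY p) x≤eXp (c3 p)) , (λ xReYp → c5 x (eX p) p xReYp X.refl)

  C2∧C3∧C6⇒S2 : C2 → C3 → C6 → S2
  C2∧C3∧C6⇒S2 c2 c3 c6 p y =
    (λ eYp≤y → c2 (eY p) y (eX p) eYp≤y (c3 p)) , (λ eXpRy → c6 (eY p) y p Y.refl eXpRy)

  S1⇒C3 : S1 → C3
  S1⇒C3 s1 p = proj₁ (s1 p (eX p)) X.refl

  C1∧S1⇒C4 : C1 → S1 → C4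
  C1∧S1⇒C4 c1 s1 x y p xReYp eXpRy = c1 x (eX p) y (proj₂ (s1 p x) xReYp) eXpRy

  S1⇒C5 : S1 → C5
  S1⇒C5 s1 x₁ x₂ p x₁ReYp eXp≤x₂ = X.trans (proj₂ (s1 p x₁) x₁ReYp) eXp≤x₂

  S2⇒C6 : S2 → C6
  S2⇒C6 s2 y₁ y₂ p y₁≤eYp eXpRy₂ = Y.trans y₁≤eYp (proj₂ (s2 p y₂) eXpRy₂)

  -- Test y₁ ≤ y₂ on the eY q below y₁: such a q lies below all of S, so eX q ≤ x, hence eX q R y₂.
  C1∧S2⇒C7 : IsExtensionPolarity → IsJoinExtension P Y eY → C1 → S2 → C7
  C1∧S2⇒C7 (embX , embY) joinY c1 s2 S x y₁ y₂ x-meet xRy₂ y₁≤eYS =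
    joinExtension-≤ {P = P} {Y} joinY λ q eYq≤y₁ →
      proj₂ (s2 q y₂) (c1 (eX q) x y₂ (eXq≤x eYq≤y₁) xRy₂)
    where
    eXq≤x : ∀ {q} → eY q Y.≤ y₁ → eX q X.≤ x
    eXq≤x eYq≤y₁ = lowerBound⇒≤meet-image {P = P} {X} x-meet λ s s∈S →
      ≤-transport {P = P} {X} {Y} embX embY (Y.trans eYq≤y₁ (y₁≤eYS s s∈S))

module PolarityDuality {c ℓ₁ ℓ₂ : Level} (P X Y : Poset c ℓ₁ ℓ₂)
         (eX : Poset.Carrier P → Poset.Carrier X) (eY : Poset.Carrier P → Poset.Carrier Y)
         (R : Poset.Carrier X → Poset.Carrier Y → Set ℓ₂) where
  open Polarity P X Y eX eY R
  open PolarityProperties (P ᵒᵖ) (Y ᵒᵖ) (X ᵒᵖ) eY eX (flip R)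
    using () renaming (C1∧S2⇒C7 to C1∧S2⇒C7-ᵒᵖ)

  -- (C8) is (C7) for the dual polarity on Pᵒᵖ, Yᵒᵖ, Xᵒᵖ with R flipped; its (S2) is our (S1).
  C2∧S1⇒C8 : IsExtensionPolarity → IsMeetExtension P X eX → C2 → S1 → C8
  C2∧S1⇒C8 (embX , embY) meetX c2 s1 T y x₁ x₂ =
    C1∧S2⇒C7-ᵒᵖ
      (orderEmbedding-ᵒᵖ {P = P} {Y} embY , orderEmbedding-ᵒᵖ {P = P} {X} embX)
      (meetExtension⇒joinExtension-ᵒᵖ {P = P} {X} meetX)
      (λ y₁ y₂ x → c2 y₂ y₁ x) s1 T y x₂ x₁

proposition4p13 : {c ℓ₁ ℓ₂ : Level} (P X Y : Poset c ℓ₁ ℓ₂)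
    (eX : Poset.Carrier P → Poset.Carrier X)
    (eY : Poset.Carrier P → Poset.Carrier Y)
    (R : Poset.Carrier X → Poset.Carrier Y → Set ℓ₂) →
    Polarity.Is0Coherent P X Y eX eY R →
    IsMeetExtension P X eX →
    IsJoinExtension P Y eY →
    (Polarity.IsGaloisPolarity P X Y eX eY R →
      Polarity.S1 P X Y eX eY R × Polarity.S2 P X Y eX eY R)
    × (Polarity.S1 P X Y eX eY R × Polarity.S2 P X Y eX eY R →
      Polarity.IsGaloisPolarity P X Y eX eY R)
proposition4p13 P X Y eX eY R (ext , c1 , c2) meetX joinY = galois⇒S1×S2 , S1×S2⇒galois
  where
  open Polarity P X Y eX eY R
  open PolarityProperties P X Y eX eY R
  open PolarityDuality P X Y eX eY R

  galois⇒S1×S2 : IsGaloisPolarity → S1 × S2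
  galois⇒S1×S2 ((_ , _ , _ , c3 , _ , c5 , c6 , _) , _) =
    C1∧C3∧C5⇒S1 c1 c3 c5 , C2∧C3∧C6⇒S2 c2 c3 c6

  S1×S2⇒galois : S1 × S2 → IsGaloisPolarity
  S1×S2⇒galois (s1 , s2) =
    ( ext , c1 , c2 , S1⇒C3 s1 , C1∧S1⇒C4 c1 s1 , S1⇒C5 s1 , S2⇒C6 s2
    , C1∧S2⇒C7 ext joinY c1 s2 , C2∧S1⇒C8 ext meetX c2 s1 )
    , meetX , joinY
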